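{- There exist graphs of diameter $2$, with arbitrarily large number $n$ of vertices, for which the longest directed path in the lowest ID scheme has length $n-2$.
   Context: Vertices have distinct IDs. Lowest ID scheme: each vertex $v$ chooses as its parent $p(v)$ the vertex of smallest ID in its closed neighborhood $N(v)\cup\{v\}$ (so $p(v)=v$, a self loop, if $v$ has smaller ID than all its neighbors). The longest directed path from $v$ is obtained by following parent pointers from $v$ until a cycle is completed; its length is its number of (non-loop) edges, and the longest directed path of the graph is the maximum over starting vertices. -}

module Defs where

open import Data.Nat using (ℕ; zero; suc; _≤_; _<_)
open import Data.Fin using (Fin)
open import Data.Fin.Properties using (_≟_)
open import Data.Bool using (Bool; true; false; _∨_; if_then_else_)
open import Data.List using (List; []; _∷_; allFin)
open import Data.Product using (Σ; ∃; _×_; _,_)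
open import Data.Sum using (_⊎_)
open import Relation.Nullary using (¬_; does)
open import Relation.Binary.PropositionalEquality using (_≡_; _≢_)

-- A finite simple (undirected, loopless) graph on the vertex set Fin n.
-- The vertex v : Fin n has ID toℕ v (so IDs are distinct and every
-- ID assignment is a relabelling of this one).
record Graph (n : ℕ) : Set where
  field
    adj   : Fin n → Fin n → Bool
    sym   : ∀ u v → adj u v ≡ adj v u
    irrefl : ∀ v → adj v v ≡ false

open Graph public

Adj : ∀ {n} → Graph n → Fin n → Fin n → Set
Adj G u v = adj G u v ≡ true

Diameter2 : ∀ {n} → Graph n → Set
Diameter2 {n} G =
  (∀ u v → u ≢ v → Adj G u v ⊎ ∃ λ w → Adj G u w × Adj G w v)
  × ∃ λ u → ∃ λ v → u ≢ v × ¬ Adj G u v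

firstSat : ∀ {n} → (Fin n → Bool) → List (Fin n) → Fin n → Fin n
firstSat P []       d = d
firstSat P (x ∷ xs) d = if P x then x else firstSat P xs d

inClosedNbhd : ∀ {n} → Graph n → Fin n → Fin n → Bool
inClosedNbhd G v w = does (w ≟ v) ∨ adj G v w

-- Lowest ID scheme: p(v) = vertex of smallest ID in N(v) ∪ {v}.
-- (allFin n lists the vertices in increasing ID order.)
parent : ∀ {n} → Graph n → Fin n → Fin n
parent {n} G v = firstSat (inClosedNbhd G v) (allFin n) v

iter : ∀ {n} → (Fin n → Fin n) → ℕ → Fin n → Fin n
iter p zero    v = v
iter p (suc k) v = p (iter p k v)

ClosesAt : ∀ {n} → (Fin n → Fin n) → Fin n → ℕ → Set
ClosesAt p v k =
  (∀ i j → i < j → j ≤ k → iter p i v ≢ iter p j v)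
  × ∃ λ i → i ≤ k × iter p (suc k) v ≡ iter p i v

-- PathLen p v L : the directed path from v has L non-loop edges.
-- The k+1 traversed edges count, except the closing edge if it is a loop.
PathLen : ∀ {n} → (Fin n → Fin n) → Fin n → ℕ → Set
PathLen p v L = ∃ λ k → ClosesAt p v k ×
  ((iter p (suc k) v ≡ iter p k v × L ≡ k)
   ⊎ (iter p (suc k) v ≢ iter p k v × L ≡ suc k))

LongestPath : ∀ {n} → (Fin n → Fin n) → ℕ → Set
LongestPath {n} p m =
  (∃ λ v → PathLen p v m) × (∀ v L → PathLen p v L → L ≤ m)

module Submission where

-- The witnesses are fan graphs.  For b : ℕ let m = b + 2 and take the
-- vertices 0, 1, …, m, where 0 — 1 — ⋯ — (m-1) is a path and the hub m
-- is joined to every other vertex.  The graph has n = m + 1 vertices and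
-- diameter 2 (any two vertices meet at the hub; 0 and 2 are not adjacent).
-- In the lowest ID scheme the hub points to 0 and every path vertex
-- j ≥ 1 points to j - 1, so the walk from m - 1 counts down through
-- m - 1 = n - 2 edges, and no walk is longer because every walk has
-- reached the root 0 after n - 2 steps.

open import Defs
open import Data.Nat using (ℕ; zero; suc; pred; _≤_; _<_; _∸_; z≤n; s≤s; _≤?_)
  renaming (_≟_ to _≟ℕ_)
open import Data.Nat.Properties
  using ( ≤-refl; ≤-trans; ≤-reflexive; ≤-<-trans; <⇒≢; >⇒≢; ≤∧≢⇒<; n≤1+n; n<1+n
        ; <⇒≤pred; pred-mono-≤; n≤0⇒n≡0; m∸n≤m; m≤n⇒m∸n≡0; ∸-monoʳ-<
        ; pred[m∸n]≡m∸[1+n]; ≰⇒>; m≤n⇒m<n∨m≡n; module ≤-Reasoning)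
open import Data.Fin using (Fin; toℕ; fromℕ; inject₁) renaming (zero to fz; suc to fs)
open import Data.Fin.Properties
  using (toℕ-injective; toℕ-fromℕ; toℕ-inject₁; toℕ≤pred[n]′)
  renaming (_≟_ to _≟F_)
open import Data.Bool using (Bool; true; false; _∨_; _xor_)
open import Data.Bool.Properties using (∨-comm; ∨-zeroʳ; xor-comm; xor-same)
open import Data.List using (tabulate)
open import Data.Product using (Σ; ∃; _×_; _,_)
open import Data.Sum using (_⊎_; inj₁; inj₂)
open import Data.Empty using (⊥-elim)
open import Relation.Nullary using (does; yes; no)
open import Relation.Nullary.Decidable using (dec-true; dec-false)
open import Relation.Binary.PropositionalEquality
  using (_≡_; _≢_; refl; trans; cong; cong₂; subst; module ≡-Reasoning)
  renaming (sym to ≡-sym)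
open import Function using (id)

iter-shift : ∀ {n} (p : Fin n → Fin n) k v → iter p (suc k) v ≡ iter p k (p v)
iter-shift p zero    v = refl
iter-shift p (suc k) v = cong p (iter-shift p k v)

-- If the walk from v is stationary at step t, its directed path has at
-- most t non-loop edges: the cycle closes at some step k ≤ t (steps t and
-- t + 1 coincide), and when k = t the closing edge is the loop at iter t.
pathLen-≤ : ∀ {n} {p : Fin n → Fin n} {v t} →
  iter p (suc t) v ≡ iter p t v → ∀ L → PathLen p v L → L ≤ t
pathLen-≤ {t = t} stationary L (k , (distinct , _) , edges) with k ≤? t
... | no k≰t =
  ⊥-elim (distinct t (suc t) (n<1+n t) (≰⇒> k≰t) (≡-sym stationary))
... | yes k≤t with edges
...   | inj₁ (_ , refl) = k≤t
...   | inj₂ (not-loop , refl) with m≤n⇒m<n∨m≡n k≤t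
...     | inj₁ k<t  = k<t
...     | inj₂ refl = ⊥-elim (not-loop stationary)

longestPath-to-root : ∀ {n t} {p : Fin (suc n) → Fin (suc n)} →
  p fz ≡ fz → (∀ v → iter p t v ≡ fz) →
  (v₀ : Fin (suc n)) → (∀ i → toℕ (iter p i v₀) ≡ t ∸ i) →
  LongestPath p t
longestPath-to-root {t = t} {p} root reach v₀ countdown =
  (v₀ , t , (distinct , t , ≤-refl , stationary v₀) , inj₁ (stationary v₀ , refl))
  , (λ v → pathLen-≤ (stationary v))
  where
  open ≡-Reasoning

  stationary : ∀ v → iter p (suc t) v ≡ iter p t v
  stationary v = begin
    p (iter p t v) ≡⟨ cong p (reach v) ⟩
    p fz           ≡⟨ root ⟩
    fz             ≡⟨ ≡-sym (reach v) ⟩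
    iter p t v     ∎

  -- the IDs t ∸ i along the walk strictly decrease for i ≤ t
  distinct : ∀ i j → i < j → j ≤ t → iter p i v₀ ≢ iter p j v₀
  distinct i j i<j j≤t same = <⇒≢ (∸-monoʳ-< i<j j≤t) (begin
    t ∸ j             ≡⟨ ≡-sym (countdown j) ⟩
    toℕ (iter p j v₀) ≡⟨ cong toℕ (≡-sym same) ⟩
    toℕ (iter p i v₀) ≡⟨ countdown i ⟩
    t ∸ i             ∎)

-- A map is descending when every step lowers the ID by at least one
-- (except at ID 0, where pred 0 = 0 forces a fixed point).
Descending : ∀ {n} → (Fin n → Fin n) → Set
Descending p = ∀ w → toℕ (p w) ≤ pred (toℕ w)

descending-fixes-zero : ∀ {n} {p : Fin (suc n) → Fin (suc n)} →
  Descending p → p fz ≡ fz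
descending-fixes-zero desc = toℕ-injective (n≤0⇒n≡0 (desc fz))

iter-descent : ∀ {n} {p : Fin n → Fin n} → Descending p →
  ∀ k v → toℕ (iter p k v) ≤ toℕ v ∸ k
iter-descent desc zero    v = ≤-refl
iter-descent {p = p} desc (suc k) v = begin
  toℕ (p (iter p k v))    ≤⟨ desc (iter p k v) ⟩
  pred (toℕ (iter p k v)) ≤⟨ pred-mono-≤ (iter-descent desc k v) ⟩
  pred (toℕ v ∸ k)        ≡⟨ pred[m∸n]≡m∸[1+n] (toℕ v) k ⟩
  toℕ v ∸ suc k           ∎
  where open ≤-Reasoning

-- If moreover every image has ID at most b, all walks reach 0 within
-- b + 1 steps: one step lands at ID ≤ b, b further steps descend to 0.
reaches-root : ∀ {n b} {p : Fin (suc n) → Fin (suc n)} → Descending p →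
  (∀ w → toℕ (p w) ≤ b) → ∀ v → iter p (suc b) v ≡ fz
reaches-root {b = b} {p} desc below v = toℕ-injective (n≤0⇒n≡0 (begin
  toℕ (iter p (suc b) v) ≡⟨ cong toℕ (iter-shift p b v) ⟩
  toℕ (iter p b (p v))   ≤⟨ iter-descent desc b (p v) ⟩
  toℕ (p v) ∸ b          ≡⟨ m≤n⇒m∸n≡0 (below v) ⟩
  0                      ∎))
  where open ≤-Reasoning

iter-countdown : ∀ {n c} {p : Fin n → Fin n} →
  (∀ w → toℕ w < c → toℕ (p w) ≡ pred (toℕ w)) →
  ∀ {v} → toℕ v < c → ∀ i → toℕ (iter p i v) ≡ toℕ v ∸ i
iter-countdown step v<c zero = refl
iter-countdown {c = c} {p = p} step {v} v<c (suc i) = begin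
  toℕ (p (iter p i v))    ≡⟨ step (iter p i v) below-c ⟩
  pred (toℕ (iter p i v)) ≡⟨ cong pred ih ⟩
  pred (toℕ v ∸ i)        ≡⟨ pred[m∸n]≡m∸[1+n] (toℕ v) i ⟩
  toℕ v ∸ suc i           ∎
  where
  open ≡-Reasoning
  ih : toℕ (iter p i v) ≡ toℕ v ∸ i
  ih = iter-countdown step v<c i
  below-c : toℕ (iter p i v) < c
  below-c = ≤-<-trans (≤-trans (≤-reflexive ih) (m∸n≤m (toℕ v) i)) v<c

-- The list search is proved for any tabulated
-- list, since the induction shifts the enumerating function.
firstSat-tabulate : ∀ {m n} (P : Fin m → Bool) (f : Fin n → Fin m) d (j : Fin n) →
  P (f j) ≡ true → (∀ i → toℕ i < toℕ j → P (f i) ≡ false) →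
  firstSat P (tabulate f) d ≡ f j
firstSat-tabulate P f d fz     holds _ rewrite holds = refl
firstSat-tabulate P f d (fs j) holds earlier rewrite earlier fz (s≤s z≤n) =
  firstSat-tabulate P (λ i → f (fs i)) d j holds (λ i i<j → earlier (fs i) (s≤s i<j))

parent-lowest : ∀ {n} (G : Graph n) (v j : Fin n) →
  inClosedNbhd G v j ≡ true → (∀ i → toℕ i < toℕ j → inClosedNbhd G v i ≡ false) →
  parent G v ≡ j
parent-lowest G v = firstSat-tabulate (inClosedNbhd G v) id v

self-inClosed : ∀ {n} (G : Graph n) v → inClosedNbhd G v v ≡ true
self-inClosed G v rewrite dec-true (v ≟F v) refl = refl

neighbour-inClosed : ∀ {n} (G : Graph n) v w → Adj G v w → inClosedNbhd G v w ≡ true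
neighbour-inClosed G v w vw rewrite vw = ∨-zeroʳ (does (w ≟F v))

outside-inClosed : ∀ {n} (G : Graph n) v w → w ≢ v → adj G v w ≡ false →
  inClosedNbhd G v w ≡ false
outside-inClosed G v w w≢v not-adj rewrite dec-false (w ≟F v) w≢v | not-adj = refl

-- The fan on vertices 0, …, m with m = b + 2: the path 0 — ⋯ — (m-1)
-- plus the hub m joined to all other vertices.  Adjacency is defined on
-- IDs; the exclusive or keeps the hub loop-free.
module Fan (b : ℕ) where

  m : ℕ
  m = suc (suc b)

  consecutive : ℕ → ℕ → Bool
  consecutive a c = does (a ≟ℕ suc c) ∨ does (c ≟ℕ suc a)

  isHub : ℕ → Bool
  isHub a = does (a ≟ℕ m)

  fanAdj : ℕ → ℕ → Bool
  fanAdj a c = consecutive a c ∨ (isHub a xor isHub c)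

  fanAdj-irrefl : ∀ a → fanAdj a a ≡ false
  fanAdj-irrefl a rewrite dec-false (a ≟ℕ suc a) (<⇒≢ (n<1+n a)) = xor-same (isHub a)

  fanAdj-hub : ∀ c → c ≢ m → fanAdj m c ≡ true
  fanAdj-hub c c≢m rewrite dec-true (m ≟ℕ m) refl | dec-false (c ≟ℕ m) c≢m =
    ∨-zeroʳ (consecutive m c)

  fanAdj-succ : ∀ a → fanAdj (suc a) a ≡ true
  fanAdj-succ a rewrite dec-true (suc a ≟ℕ suc a) refl = refl

  fanAdj-far : ∀ a c → a ≢ suc c → c ≢ suc a → a ≢ m → c ≢ m → fanAdj a c ≡ false
  fanAdj-far a c e₁ e₂ e₃ e₄ rewrite dec-false (a ≟ℕ suc c) e₁ | dec-false (c ≟ℕ suc a) e₂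
    | dec-false (a ≟ℕ m) e₃ | dec-false (c ≟ℕ m) e₄ = refl

  fan : Graph (suc m)
  fan = record
    { adj    = λ u v → fanAdj (toℕ u) (toℕ v)
    ; sym    = λ u v → cong₂ _∨_ (∨-comm (does (toℕ u ≟ℕ suc (toℕ v))) _)
                                 (xor-comm (isHub (toℕ u)) (isHub (toℕ v)))
    ; irrefl = λ v → fanAdj-irrefl (toℕ v)
    }

  hub : Fin (suc m)
  hub = fromℕ m

  hub-or-path : ∀ v → v ≡ hub ⊎ toℕ v < m
  hub-or-path v with toℕ v ≟ℕ m
  ... | yes v≡m = inj₁ (toℕ-injective (trans v≡m (≡-sym (toℕ-fromℕ m))))
  ... | no  v≢m = inj₂ (≤∧≢⇒< (toℕ≤pred[n]′ v) v≢m)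

  hub-adj : ∀ v → toℕ v < m → Adj fan hub v
  hub-adj v v<m = subst (λ a → fanAdj a (toℕ v) ≡ true) (≡-sym (toℕ-fromℕ m))
                        (fanAdj-hub (toℕ v) (<⇒≢ v<m))

  adj-hub : ∀ v → toℕ v < m → Adj fan v hub
  adj-hub v v<m = trans (Graph.sym fan v hub) (hub-adj v v<m)

  within-two : ∀ u v → u ≢ v → Adj fan u v ⊎ ∃ λ w → Adj fan u w × Adj fan w v
  within-two u v u≢v with hub-or-path u | hub-or-path v
  ... | inj₁ refl | inj₁ refl = ⊥-elim (u≢v refl)
  ... | inj₁ refl | inj₂ v<m  = inj₁ (hub-adj v v<m)
  ... | inj₂ u<m  | inj₁ refl = inj₁ (adj-hub u u<m)
  ... | inj₂ u<m  | inj₂ v<m  = inj₂ (hub , adj-hub u u<m , hub-adj v v<m)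

  p : Fin (suc m) → Fin (suc m)
  p = parent fan

  parent-hub : p hub ≡ fz
  parent-hub = parent-lowest fan hub fz
    (neighbour-inClosed fan hub fz (hub-adj fz (s≤s z≤n))) (λ _ ())

  -- a path vertex j ≥ 1 has closed neighbourhood {j-1, j, j+1, m}
  parent-path : ∀ v → toℕ v < m → toℕ (p v) ≡ pred (toℕ v)
  parent-path fz     _   = cong toℕ (parent-lowest fan fz fz (self-inClosed fan fz) (λ _ ()))
  parent-path (fs w) w<m = trans (cong toℕ (parent-lowest fan (fs w) (inject₁ w) predecessor lower))
                                 (toℕ-inject₁ w)
    where
    predecessor : inClosedNbhd fan (fs w) (inject₁ w) ≡ true
    predecessor = neighbour-inClosed fan (fs w) (inject₁ w)
      (subst (λ c → fanAdj (suc (toℕ w)) c ≡ true) (≡-sym (toℕ-inject₁ w)) (fanAdj-succ (toℕ w)))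

    lower : ∀ i → toℕ i < toℕ (inject₁ w) → inClosedNbhd fan (fs w) i ≡ false
    lower i i<inj = outside-inClosed fan (fs w) i (λ e → <⇒≢ i<sw (cong toℕ e))
      (fanAdj-far (suc (toℕ w)) (toℕ i) (λ e → >⇒≢ i<w (cong pred e))
        (<⇒≢ (≤-trans i<sw (n≤1+n _))) (<⇒≢ w<m) (<⇒≢ (≤-<-trans (n≤1+n _) (≤-<-trans i<sw w<m))))
      where
      i<w : toℕ i < toℕ w
      i<w = subst (toℕ i <_) (toℕ-inject₁ w) i<inj
      i<sw : toℕ i < suc (toℕ w)
      i<sw = ≤-trans i<w (n≤1+n _)

  parent-descending : Descending p
  parent-descending v with hub-or-path v
  ... | inj₁ refl rewrite parent-hub = z≤n
  ... | inj₂ v<m  = ≤-reflexive (parent-path v v<m)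

  parent-below : ∀ v → toℕ (p v) ≤ b
  parent-below v with hub-or-path v
  ... | inj₁ refl rewrite parent-hub = z≤n
  ... | inj₂ v<m  = subst (_≤ b) (≡-sym (parent-path v v<m)) (pred-mono-≤ (<⇒≤pred v<m))

  top : Fin (suc m)
  top = inject₁ (fromℕ (suc b))

  top-countdown : ∀ i → toℕ (iter p i top) ≡ suc b ∸ i
  top-countdown i = trans (iter-countdown parent-path top<m i) (cong (_∸ i) top-id)
    where
    top-id : toℕ top ≡ suc b
    top-id = trans (toℕ-inject₁ (fromℕ (suc b))) (toℕ-fromℕ (suc b))
    top<m : toℕ top < m
    top<m = subst (_< m) (≡-sym top-id) (n<1+n (suc b))

  longest : LongestPath p (suc b)
  longest = longestPath-to-root (descending-fixes-zero parent-descending)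
    (reaches-root parent-descending parent-below) top top-countdown

fan-diameter2 : ∀ N → Diameter2 (Fan.fan (suc N))
fan-diameter2 N = Fan.within-two (suc N) , fz , fs (fs fz) , (λ ()) , (λ ())

mainTheorem14 : ∀ (N : ℕ) → ∃ λ (n : ℕ) → N ≤ n ×
    Σ (Graph n) (λ G → Diameter2 G × LongestPath (parent G) (n ∸ 2))
mainTheorem14 N =
  suc (suc (suc (suc N))) , N≤4+N , Fan.fan (suc N) , fan-diameter2 N , Fan.longest (suc N)
  where
  N≤4+N : N ≤ suc (suc (suc (suc N)))
  N≤4+N = ≤-trans (n≤1+n N) (≤-trans (n≤1+n _) (≤-trans (n≤1+n _) (n≤1+n _)))
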